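{- For every integer $n\ge1$, $$P_n(t;X_n,Y_n)=\sum_{i=1}^{n}x_{i,1}^{0}x_{i,2}^{1}\cdots x_{i,i}^{i-1}\cdot P_{n-1}\big(t;\,R_2(X_n,Y_n,i),\,R_1(Y_n,i)\big).$$
   Context: For $\pi\in\mathcal S_m$, $N_{2341}(\pi)$ is the number of index quadruples $a<b<c<d$ with $\pi_d<\pi_a<\pi_b<\pi_c$. With variables $t,x_{i,j},y_{i,j}$ ($1\le j\le i$), let $$\mathrm{weight}(\pi)=t^{N_{2341}(\pi)}\prod_{1\le j\le i\le m}x_{i,j}^{\#\{(a,b):\,a<b,\ \pi_a>\pi_b,\ \pi_a=i,\ \pi_b<j\}}\;y_{i,j}^{\#\{(a,b,c):\,a<b<c,\ \pi_c<\pi_a<\pi_b,\ \pi_a=i,\ \pi_c<j\}}$$ and $P_m(t;X_m,Y_m)=\sum_{\pi\in\mathcal S_m}\mathrm{weight}(\pi)$, where $X_m=(x_{i,j})$, $Y_m=(y_{i,j})$ are $m\times m$ matrices of variables (entries above the diagonal ignored); $\mathcal S_0$ consists of the empty permutation, so $P_0=1$. For $m\times m$ matrices $M,N$, $P_m(t;M,N)$ denotes $P_m$ with $x_{b,c}\to M_{b,c}$ and $y_{b,c}\to N_{b,c}$ for all $1\le c\le b\le m$. For an $n\times n$ matrix $M$ and $1\le i<n$, $R_1(M,i)$ is the $(n-1)\times(n-1)$ matrix with $(b,c)$ entry $M_{b',c}$ if $c<i$, $t\,M_{b',i}M_{b',i+1}$ if $c=i$, $M_{b',c+1}$ if $c>i$,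 where $b'=b$ if $b<i$ and $b'=b+1$ if $b\ge i$. For $n\times n$ matrices $X,Y$ and $1\le i<n$, $R_2(X,Y,i)$ is the $(n-1)\times(n-1)$ matrix with $(b,c)$ entry: for $b<i$: $X_{b,c}$ if $c<i$, $Y_{i,i}X_{b,i}X_{b,i+1}$ if $c=i$, $X_{b,c+1}$ if $c>i$; for $b\ge i$: $Y_{i,c}X_{b+1,c}$ if $c<i$, $Y_{i,i}X_{b+1,i}X_{b+1,i+1}$ if $c=i$, $X_{b+1,c+1}$ if $c>i$. For $i=n$, $R_1(M,n)$ is $M$ with its $n$-th row and column deleted, and $R_2(X,Y,n)$ is $X$ with its $n$-th row and column deleted. -}

module Defs where

open import Level using (Level)
open import Data.Nat as ℕ using (ℕ; zero; suc; _∸_; _<_; _≟_; _<?_)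
open import Data.Nat.Properties using ()
open import Data.List using (List; []; _∷_; _++_; map; concatMap; length; filter)
open import Data.Product using (_×_; _,_)
open import Relation.Nullary using (yes; no; Dec)
open import Relation.Nullary.Decidable using (_×-dec_)
open import Algebra.Bundles using (CommutativeRing)

-- Permutations of {1,…,m}, written in one-line notation as lists
-- π = [π₁, …, π_m] of natural numbers.

insertAll : ℕ → List ℕ → List (List ℕ)
insertAll v []       = (v ∷ []) ∷ []
insertAll v (u ∷ us) = (v ∷ u ∷ us) ∷ map (u ∷_) (insertAll v us)

S : ℕ → List (List ℕ)
S zero    = [] ∷ []
S (suc m) = concatMap (insertAll (suc m)) (S m)

-- Position pairs / triples / quadruples a<b(<c<d), recorded by their values.

pairs : List ℕ → List (ℕ × ℕ)
pairs []       = []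
pairs (u ∷ us) = map (u ,_) us ++ pairs us

triples : List ℕ → List (ℕ × ℕ × ℕ)
triples []       = []
triples (u ∷ us) = map (λ { (v , w) → u , v , w }) (pairs us) ++ triples us

quads : List ℕ → List (ℕ × ℕ × ℕ × ℕ)
quads []       = []
quads (u ∷ us) = map (λ { (v , w , z) → u , v , w , z }) (triples us) ++ quads us

N2341 : List ℕ → ℕ
N2341 π = length (filter (λ { (pa , pb , pc , pd) →
            (pd <? pa) ×-dec ((pa <? pb) ×-dec (pb <? pc)) }) (quads π))

xExp : List ℕ → ℕ → ℕ → ℕ
xExp π i j = length (filter (λ { (pa , pb) →
            (pb <? pa) ×-dec ((pa ≟ i) ×-dec (pb <? j)) }) (pairs π))

yExp : List ℕ → ℕ → ℕ → ℕ
yExp π i j = length (filter (λ { (pa , pb , pc) →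
            (pc <? pa) ×-dec ((pa <? pb) ×-dec ((pa ≟ i) ×-dec (pc <? j))) }) (triples π))

-- Everything is evaluated in an arbitrary commutative ring R; a
-- polynomial identity in t, x_{i,j}, y_{i,j} is the same as its
-- validity under every evaluation in every commutative ring.
-- Matrices are 1-indexed functions ℕ → ℕ → R (only entries 1 ≤ c ≤ b ≤ m
-- are ever used).

module WithRing {c ℓ : Level} (R : CommutativeRing c ℓ) where
  open CommutativeRing R

  Mat : Set c
  Mat = ℕ → ℕ → Carrier

  infixr 8 _^_
  _^_ : Carrier → ℕ → Carrier
  x ^ zero  = 1#
  x ^ suc k = x * (x ^ k)

  prod : ℕ → (ℕ → Carrier) → Carrier
  prod zero    f = 1#
  prod (suc n) f = prod n f * f (suc n)

  sum : ℕ → (ℕ → Carrier) → Carrier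
  sum zero    f = 0#
  sum (suc n) f = sum n f + f (suc n)

  weight : ℕ → Carrier → Mat → Mat → List ℕ → Carrier
  weight m t X Y π =
    (t ^ N2341 π) *
    prod m (λ i → prod i (λ j → (X i j ^ xExp π i j) * (Y i j ^ yExp π i j)))

  sumList : List (List ℕ) → (List ℕ → Carrier) → Carrier
  sumList []       f = 0#
  sumList (π ∷ πs) f = f π + sumList πs f

  P : ℕ → Carrier → Mat → Mat → Carrier
  P m t X Y = sumList (S m) (weight m t X Y)

  R1 : Carrier → ℕ → Mat → ℕ → Mat
  R1 t n M i with i ≟ n
  ... | yes _ = M      -- delete n-th row and column
  ... | no  _ = λ b c →
        let b′ = row b in
        caseC b′ c
    where
      row : ℕ → ℕ
      row b with b <? i
      ... | yes _ = b
      ... | no  _ = suc b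
      caseC : ℕ → ℕ → Carrier
      caseC b′ c with c <? i | c ≟ i
      ... | yes _ | _     = M b′ c
      ... | no  _ | yes _ = t * M b′ i * M b′ (suc i)
      ... | no  _ | no  _ = M b′ (suc c)

  R2 : ℕ → Mat → Mat → ℕ → Mat
  R2 n X Y i with i ≟ n
  ... | yes _ = X      -- delete n-th row and column of X
  ... | no  _ = entry
    where
      entry : Mat
      entry b c with b <? i | c <? i | c ≟ i
      ... | yes _ | yes _ | _     = X b c
      ... | yes _ | no  _ | yes _ = Y i i * X b i * X b (suc i)
      ... | yes _ | no  _ | no  _ = X b (suc c)
      ... | no  _ | yes _ | _     = Y i c * X (suc b) c
      ... | no  _ | no  _ | yes _ = Y i i * X (suc b) i * X (suc b) (suc i)
      ... | no  _ | no  _ | no  _ = X (suc b) (suc c)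

  monomial : Mat → ℕ → Carrier
  monomial X i = prod i (λ j → X i j ^ (j ∸ 1))

module Submission where

-- Every permutation of [1, n+1] is i ∷ map (punchIn i) σ for exactly one first letter i and one
-- permutation σ of [1, n]. The weight of a permutation is a product of local factors over its
-- position tuples: a pair (a, b) contributes ∏_{b<j≤a} x_{a,j} (empty unless a > b), a triple (a, b, c)
-- with a < b contributes ∏_{c<j≤a} y_{a,j}, and a 2341-occurrence contributes t. Split off the tuples
-- starting at the first letter i. The pairs (i, v) give x_{i,1}^0 ⋯ x_{i,i}^{i-1}, since for j ≤ i exactly
-- j - 1 of the remaining letters lie below j. A pair (u, v) of σ together with the triple (i, u′, v′) gives
-- the pair factor of (u, v) for R₂(X, Y, i), and a triple (u, v, w) of σ together with the quadruple
-- (i, u′, v′, w′) gives its triple factor for R₁(Y, i): relabelling merges columns i and i + 1 of the rows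
-- below i. Quadruples avoiding i keep their factor because punchIn i preserves order.

open import Defs
open import Level using (Level)
open import Algebra.Bundles using (CommutativeRing; CommutativeMonoid)
open import Data.Bool using (Bool; true; false; _∧_)
open import Data.Bool.Properties using (∧-zeroʳ)
open import Data.List using (List; []; _∷_; _++_; map; concatMap; length; filter)
open import Data.List.Properties using (map-++; map-∘; map-id-local)
open import Data.List.Membership.Propositional using (_∈_)
open import Data.List.Relation.Unary.All as All using (All; []; _∷_)
import Data.List.Relation.Unary.All.Properties as All
open import Data.Nat using (ℕ; zero; suc; _≤_; _<_; _∸_; _<?_; _≤?_; _≟_; z≤n; s≤s)
open import Data.Nat.Properties
  using (≤-refl; ≤-trans; ≤-pred; <-irrefl; <-asym; <-trans; <-≤-trans; ≤-<-trans; <⇒≤; <⇒≢; <⇒≱; ≤⇒≯; ≮⇒≥;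
         m≤n⇒m≤1+n; m<n⇒m<1+n; n<1+n; ≤∧≢⇒<; m≤n⇒m<n∨m≡n; <-cmp)
open import Data.Product using (_×_; _,_; proj₁; proj₂; map₂)
open import Data.Sum using (inj₁; inj₂)
open import Function using (_∘_)
open import Relation.Binary.Definitions using (tri<; tri≈; tri>)
open import Relation.Binary.PropositionalEquality as ≡ using (_≡_; _≢_; cong; cong₂; module ≡-Reasoning)
open import Relation.Nullary using (Dec; yes; no; does; ¬_; contradiction)
open import Relation.Nullary.Decidable using (dec-true; dec-false; _×-dec_)
open import Relation.Unary using (Decidable)

does-≡ : {A B : Set} (a? : Dec A) (b? : Dec B) → (A → B) → (B → A) → does a? ≡ does b?
does-≡ (yes _) (yes _) _ _ = ≡.refl
does-≡ (yes a) (no ¬b) f _ = contradiction (f a) ¬b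
does-≡ (no ¬a) (yes b) _ g = contradiction (g b) ¬a
does-≡ (no _)  (no _)  _ _ = ≡.refl

∧-does-absorb : {A B : Set} (a? : Dec A) (b? : Dec B) → (B → A) → does a? ∧ does b? ≡ does b?
∧-does-absorb a? (yes b) b⇒a rewrite dec-true a? (b⇒a b) = ≡.refl
∧-does-absorb a? (no _)  _   = ∧-zeroʳ (does a?)

_∈[1,_] : ℕ → ℕ → Set
v ∈[1, n ] = 1 ≤ v × v ≤ n

punchIn : ℕ → ℕ → ℕ
punchIn i v with v <? i
... | yes _ = v
... | no  _ = suc v

punchIn-< : ∀ {i v} → v < i → punchIn i v ≡ v
punchIn-< {i} {v} v<i with v <? i
... | yes _   = ≡.refl
... | no  v≮i = contradiction v<i v≮i

punchIn-≮ : ∀ {i v} → ¬ v < i → punchIn i v ≡ suc v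
punchIn-≮ {i} {v} v≮i with v <? i
... | yes v<i = contradiction v<i v≮i
... | no  _   = ≡.refl

punchIn-∈ : ∀ i {n v} → v ∈[1, n ] → punchIn i v ∈[1, suc n ]
punchIn-∈ i {v = v} (1≤v , v≤n) with v <? i
... | yes _ = 1≤v , m≤n⇒m≤1+n v≤n
... | no  _ = s≤s z≤n , s≤s v≤n

<?-punchIn : ∀ i a b → does (punchIn i a <? punchIn i b) ≡ does (a <? b)
<?-punchIn i a b with a <? i | b <? i
... | yes a<i | yes b<i = ≡.refl
... | yes a<i | no  b≮i = does-≡ (a <? suc b) (a <? b)
      (λ _ → <-≤-trans a<i (≮⇒≥ b≮i)) (λ a<b → m<n⇒m<1+n a<b)
... | no  a≮i | yes b<i = does-≡ (suc a <? b) (a <? b)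
      (λ 1+a<b → contradiction (<-trans (<⇒≤ 1+a<b) b<i) a≮i)
      (λ a<b → contradiction (<-trans a<b b<i) a≮i)
... | no  a≮i | no  b≮i = does-≡ (suc a <? suc b) (a <? b) ≤-pred s≤s

<?-punchIn-below : ∀ i {j} v → j ≤ i → does (punchIn i v <? j) ≡ does (v <? j)
<?-punchIn-below i {j} v j≤i with v <? i
... | yes _   = ≡.refl
... | no  v≮i = does-≡ (suc v <? j) (v <? j)
      (λ 1+v<j → contradiction (<-≤-trans (<⇒≤ 1+v<j) j≤i) v≮i)
      (λ v<j → contradiction (<-≤-trans v<j j≤i) v≮i)

<?-punchIn-above : ∀ i {j} v → i ≤ j → does (punchIn i v <? suc j) ≡ does (v <? j)
<?-punchIn-above i {j} v i≤j with v <? i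
... | yes v<i = does-≡ (v <? suc j) (v <? j) (λ _ → <-≤-trans v<i i≤j) m<n⇒m<1+n
... | no  _   = ≡.refl

insertAll-map : ∀ (f : ℕ → ℕ) v l → insertAll (f v) (map f l) ≡ map (map f) (insertAll v l)
insertAll-map f v []       = ≡.refl
insertAll-map f v (u ∷ us) = cong ((f v ∷ f u ∷ map f us) ∷_) (begin
  map (f u ∷_) (insertAll (f v) (map f us))  ≡⟨ cong (map (f u ∷_)) (insertAll-map f v us) ⟩
  map (f u ∷_) (map (map f) (insertAll v us)) ≡⟨ map-∘ (insertAll v us) ⟨
  map (map f ∘ (u ∷_)) (insertAll v us)      ≡⟨ map-∘ (insertAll v us) ⟩
  map (map f) (map (u ∷_) (insertAll v us))  ∎)
  where open ≡-Reasoning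

insertAll-All : ∀ {P : ℕ → Set} {v} l → P v → All P l → All (All P) (insertAll v l)
insertAll-All []       pv []         = (pv ∷ []) ∷ []
insertAll-All (u ∷ us) pv (pu ∷ pus) =
  (pv ∷ pu ∷ pus) ∷ All.map⁺ (All.map (pu ∷_) (insertAll-All us pv pus))

S-bounded : ∀ n → All (All (_∈[1, n ])) (S n)
S-bounded zero    = [] ∷ []
S-bounded (suc n) = All.concat⁺ (All.map⁺ (All.map
  (λ {σ} σ⊆[1,n] → insertAll-All σ (s≤s z≤n , ≤-refl) (All.map (map₂ m≤n⇒m≤1+n) σ⊆[1,n]))
  (S-bounded n)))

insertAll-punchIn : ∀ {i n} σ → i ≤ suc n →
  insertAll (suc (suc n)) (map (punchIn i) σ) ≡ map (map (punchIn i)) (insertAll (suc n) σ)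
insertAll-punchIn {i} {n} σ i≤1+n = ≡.trans
  (cong (λ v → insertAll v (map (punchIn i) σ)) (≡.sym (punchIn-≮ (≤⇒≯ i≤1+n))))
  (insertAll-map (punchIn i) (suc n) σ)

map-punchIn-beyond : ∀ {n} σ → All (_∈[1, n ]) σ → map (punchIn (suc n)) σ ≡ σ
map-punchIn-beyond σ σ⊆[1,n] = map-id-local (All.map (λ (_ , v≤n) → punchIn-< (s≤s v≤n)) σ⊆[1,n])

pairs-All : ∀ {P : ℕ → Set} {l} → All P l → All (P ∘ proj₁) (pairs l)
pairs-All []         = []
pairs-All (pu ∷ pus) = All.++⁺ (All.map⁺ (All.universal (λ _ → pu) _)) (pairs-All pus)

triples-All : ∀ {P : ℕ → Set} {l} → All P l → All (P ∘ proj₁) (triples l)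
triples-All []         = []
triples-All (pu ∷ pus) = All.++⁺ (All.map⁺ (All.universal (λ _ → pu) _)) (triples-All pus)

map² : (ℕ → ℕ) → ℕ × ℕ → ℕ × ℕ
map² g (a , b) = g a , g b

map³ : (ℕ → ℕ) → ℕ × ℕ × ℕ → ℕ × ℕ × ℕ
map³ g (a , p) = g a , map² g p

map⁴ : (ℕ → ℕ) → ℕ × ℕ × ℕ × ℕ → ℕ × ℕ × ℕ × ℕ
map⁴ g (a , p) = g a , map³ g p

pairs-map : ∀ g l → pairs (map g l) ≡ map (map² g) (pairs l)
pairs-map g []       = ≡.refl
pairs-map g (u ∷ us) = begin
  map (g u ,_) (map g us) ++ pairs (map g us)
    ≡⟨ cong₂ _++_ (≡.sym (map-∘ us)) (pairs-map g us) ⟩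
  map (map² g ∘ (u ,_)) us ++ map (map² g) (pairs us)
    ≡⟨ cong (_++ _) (map-∘ us) ⟩
  map (map² g) (map (u ,_) us) ++ map (map² g) (pairs us)
    ≡⟨ map-++ (map² g) (map (u ,_) us) (pairs us) ⟨
  map (map² g) (pairs (u ∷ us)) ∎
  where open ≡-Reasoning

triples-map : ∀ g l → triples (map g l) ≡ map (map³ g) (triples l)
triples-map g []       = ≡.refl
triples-map g (u ∷ us) = begin
  map (g u ,_) (pairs (map g us)) ++ triples (map g us)
    ≡⟨ cong₂ _++_ (cong (map (g u ,_)) (pairs-map g us)) (triples-map g us) ⟩
  map (g u ,_) (map (map² g) (pairs us)) ++ map (map³ g) (triples us)
    ≡⟨ cong (_++ _) (≡.trans (≡.sym (map-∘ (pairs us))) (map-∘ (pairs us))) ⟩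
  map (map³ g) (map (u ,_) (pairs us)) ++ map (map³ g) (triples us)
    ≡⟨ map-++ (map³ g) (map (u ,_) (pairs us)) (triples us) ⟨
  map (map³ g) (triples (u ∷ us)) ∎
  where open ≡-Reasoning

quads-map : ∀ g l → quads (map g l) ≡ map (map⁴ g) (quads l)
quads-map g []       = ≡.refl
quads-map g (u ∷ us) = begin
  map (g u ,_) (triples (map g us)) ++ quads (map g us)
    ≡⟨ cong₂ _++_ (cong (map (g u ,_)) (triples-map g us)) (quads-map g us) ⟩
  map (g u ,_) (map (map³ g) (triples us)) ++ map (map⁴ g) (quads us)
    ≡⟨ cong (_++ _) (≡.trans (≡.sym (map-∘ (triples us))) (map-∘ (triples us))) ⟩
  map (map⁴ g) (map (u ,_) (triples us)) ++ map (map⁴ g) (quads us)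
    ≡⟨ map-++ (map⁴ g) (map (u ,_) (triples us)) (quads us) ⟨
  map (map⁴ g) (quads (u ∷ us)) ∎
  where open ≡-Reasoning

module BigOperator {c ℓ} (M : CommutativeMonoid c ℓ) where
  open CommutativeMonoid M
  open import Relation.Binary.Reasoning.Setoid setoid
  open import Algebra.Solver.CommutativeMonoid M using (solve; _⊕_; _⊜_)

  infixr 8 _^ᵇ_
  _^ᵇ_ : Carrier → Bool → Carrier
  x ^ᵇ true  = x
  x ^ᵇ false = ε

  ^ᵇ-distrib : ∀ x y b → (x ∙ y) ^ᵇ b ≈ x ^ᵇ b ∙ y ^ᵇ b
  ^ᵇ-distrib x y true  = refl
  ^ᵇ-distrib x y false = sym (identityˡ ε)

  ^ᵇ-congˡ : ∀ {x y} b → x ≈ y → x ^ᵇ b ≈ y ^ᵇ b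
  ^ᵇ-congˡ true  x≈y = x≈y
  ^ᵇ-congˡ false _   = refl

  ^ᵇ-∧ : ∀ x p q → x ^ᵇ (p ∧ q) ≡ (x ^ᵇ q) ^ᵇ p
  ^ᵇ-∧ x true  q = ≡.refl
  ^ᵇ-∧ x false q = ≡.refl

  ^ᵇ-comm : ∀ x p q → (x ^ᵇ p) ^ᵇ q ≡ (x ^ᵇ q) ^ᵇ p
  ^ᵇ-comm x true  true  = ≡.refl
  ^ᵇ-comm x true  false = ≡.refl
  ^ᵇ-comm x false true  = ≡.refl
  ^ᵇ-comm x false false = ≡.refl

  ε-^ᵇ : ∀ b → ε ^ᵇ b ≡ ε
  ε-^ᵇ true  = ≡.refl
  ε-^ᵇ false = ≡.refl

  ^ᵇ-guarded-comm : ∀ {A : Set} x (a? : Dec A) {p q} → (A → p ≡ q) →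
                    (x ^ᵇ does a?) ^ᵇ p ≡ (x ^ᵇ q) ^ᵇ does a?
  ^ᵇ-guarded-comm x (yes a) p≡q       = cong (x ^ᵇ_) (p≡q a)
  ^ᵇ-guarded-comm x (no _)  {p = p} _ = ε-^ᵇ p

  interchange : ∀ a b c d → (a ∙ b) ∙ (c ∙ d) ≈ (a ∙ c) ∙ (b ∙ d)
  interchange = solve 4 (λ a b c d → (a ⊕ b) ⊕ (c ⊕ d) ⊜ (a ⊕ c) ⊕ (b ⊕ d)) refl

  foldMap : {A : Set} → List A → (A → Carrier) → Carrier
  foldMap []       f = ε
  foldMap (x ∷ xs) f = f x ∙ foldMap xs f

  foldMap-cong : ∀ {A : Set} (xs : List A) {f g : A → Carrier} →
                 All (λ x → f x ≈ g x) xs → foldMap xs f ≈ foldMap xs g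
  foldMap-cong []       []         = refl
  foldMap-cong (x ∷ xs) (fx≈gx ∷ h) = ∙-cong fx≈gx (foldMap-cong xs h)

  foldMap-++ : ∀ {A : Set} (xs ys : List A) f → foldMap (xs ++ ys) f ≈ foldMap xs f ∙ foldMap ys f
  foldMap-++ []       ys f = sym (identityˡ _)
  foldMap-++ (x ∷ xs) ys f = trans (∙-congˡ (foldMap-++ xs ys f)) (sym (assoc _ _ _))

  foldMap-map : ∀ {A B : Set} (g : A → B) xs f → foldMap (map g xs) f ≡ foldMap xs (f ∘ g)
  foldMap-map g []       f = ≡.refl
  foldMap-map g (x ∷ xs) f = ≡.cong (f (g x) ∙_) (foldMap-map g xs f)

  foldMap-map-++ : ∀ {A B : Set} (g : A → B) xs ys f →
                   foldMap (map g xs ++ ys) f ≈ foldMap xs (f ∘ g) ∙ foldMap ys f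
  foldMap-map-++ g xs ys f = trans (foldMap-++ (map g xs) ys f) (∙-congʳ (reflexive (foldMap-map g xs f)))

  foldMap-concatMap : ∀ {A B : Set} (g : A → List B) xs f →
                      foldMap (concatMap g xs) f ≈ foldMap xs (λ x → foldMap (g x) f)
  foldMap-concatMap g []       f = refl
  foldMap-concatMap g (x ∷ xs) f =
    trans (foldMap-++ (g x) (concatMap g xs) f) (∙-congˡ (foldMap-concatMap g xs f))

  foldMap-distrib : ∀ {A : Set} (xs : List A) f g →
                    foldMap xs (λ x → f x ∙ g x) ≈ foldMap xs f ∙ foldMap xs g
  foldMap-distrib []       f g = sym (identityˡ ε)
  foldMap-distrib (x ∷ xs) f g =
    trans (∙-congˡ (foldMap-distrib xs f g)) (interchange _ _ _ _)

  foldRange : ℕ → (ℕ → Carrier) → Carrier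
  foldRange zero    f = ε
  foldRange (suc n) f = foldRange n f ∙ f (suc n)

  foldRange-cong : ∀ n {f g : ℕ → Carrier} → (∀ j → j ∈[1, n ] → f j ≈ g j) →
                   foldRange n f ≈ foldRange n g
  foldRange-cong zero    f≈g = refl
  foldRange-cong (suc n) f≈g = ∙-cong (foldRange-cong n (λ j → f≈g j ∘ map₂ m≤n⇒m≤1+n))
                                      (f≈g (suc n) (s≤s z≤n , ≤-refl))

  foldRange-ε : ∀ n {f : ℕ → Carrier} → (∀ j → j ∈[1, n ] → f j ≈ ε) → foldRange n f ≈ ε
  foldRange-ε zero    f≈ε = refl
  foldRange-ε (suc n) f≈ε = trans (∙-cong (foldRange-ε n (λ j → f≈ε j ∘ map₂ m≤n⇒m≤1+n))
                                          (f≈ε (suc n) (s≤s z≤n , ≤-refl)))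
                                  (identityˡ ε)

  foldRange-distrib : ∀ n f g → foldRange n (λ j → f j ∙ g j) ≈ foldRange n f ∙ foldRange n g
  foldRange-distrib zero    f g = sym (identityˡ ε)
  foldRange-distrib (suc n) f g =
    trans (∙-congʳ (foldRange-distrib n f g)) (interchange _ _ _ _)

  foldRange-^ᵇ : ∀ n b f → foldRange n (λ j → f j ^ᵇ b) ≈ foldRange n f ^ᵇ b
  foldRange-^ᵇ n true  f = refl
  foldRange-^ᵇ n false f = foldRange-ε n (λ _ _ → refl)

  foldRange-single : ∀ n {a} {f : ℕ → Carrier} → a ∈[1, n ] → (∀ j → j ≢ a → f j ≈ ε) →
                     foldRange n f ≈ f a
  foldRange-single zero    (s≤s _ , ()) _
  foldRange-single (suc n) {a} (1≤a , a≤1+n) f≈ε with a ≟ suc n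
  ... | yes ≡.refl = trans (∙-congʳ (foldRange-ε n (λ j (_ , j≤n) → f≈ε j (<⇒≢ (s≤s j≤n)))))
                           (identityˡ _)
  ... | no a≢1+n   = trans (∙-cong (foldRange-single n (1≤a , ≤-pred (≤∧≢⇒< a≤1+n a≢1+n)) f≈ε)
                                   (f≈ε (suc n) (a≢1+n ∘ ≡.sym)))
                           (identityʳ _)

  foldRange-foldMap : ∀ {A : Set} n (xs : List A) (f : ℕ → A → Carrier) →
    foldRange n (λ j → foldMap xs (f j)) ≈ foldMap xs (λ x → foldRange n (λ j → f j x))
  foldRange-foldMap n []       f = foldRange-ε n (λ _ _ → refl)
  foldRange-foldMap n (x ∷ xs) f =
    trans (foldRange-distrib n (λ j → f j x) (λ j → foldMap xs (f j)))
          (∙-congˡ (foldRange-foldMap n xs f))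

  foldRange-truncate : ∀ n {i} f → i ≤ n → foldRange n (λ j → f j ^ᵇ does (j ≤? i)) ≈ foldRange i f
  foldRange-truncate zero    f z≤n = refl
  foldRange-truncate (suc n) {i} f i≤1+n with m≤n⇒m<n∨m≡n i≤1+n
  ... | inj₂ ≡.refl = foldRange-cong (suc n) (λ j (_ , j≤i) →
                        reflexive (cong (f j ^ᵇ_) (dec-true (j ≤? i) j≤i)))
  ... | inj₁ i<1+n  = trans (∙-cong (foldRange-truncate n f (≤-pred i<1+n))
                                    (reflexive (cong (f (suc n) ^ᵇ_) (dec-false (suc n ≤? i) (<⇒≱ i<1+n)))))
                            (identityʳ _)

  foldRange-merge : ∀ u {i c} {g h : ℕ → Carrier} → 1 ≤ i → i ≤ u →
    (∀ j → j < i → h j ≈ g j) → h i ≈ c ∙ (g i ∙ g (suc i)) → (∀ j → i < j → h j ≈ g (suc j)) →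
    c ∙ foldRange (suc u) g ≈ foldRange u h
  foldRange-merge zero    (s≤s _) () _ _ _
  foldRange-merge (suc u) {i} {c} {g} {h} 1≤i i≤1+u below at above with m≤n⇒m<n∨m≡n i≤1+u
  ... | inj₂ ≡.refl = begin
    c ∙ ((foldRange u g ∙ g (suc u)) ∙ g (suc (suc u)))
      ≈⟨ solve 4 (λ c a b d → c ⊕ ((a ⊕ b) ⊕ d) ⊜ a ⊕ (c ⊕ (b ⊕ d))) refl c _ _ _ ⟩
    foldRange u g ∙ (c ∙ (g (suc u) ∙ g (suc (suc u))))
      ≈⟨ ∙-cong (foldRange-cong u (λ j (_ , j≤u) → sym (below j (s≤s j≤u)))) (sym at) ⟩
    foldRange u h ∙ h (suc u) ∎
  ... | inj₁ i<1+u  = begin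
    c ∙ (foldRange (suc u) g ∙ g (suc (suc u)))
      ≈⟨ assoc _ _ _ ⟨
    (c ∙ foldRange (suc u) g) ∙ g (suc (suc u))
      ≈⟨ ∙-cong (foldRange-merge u 1≤i (≤-pred i<1+u) below at above) (sym (above (suc u) i<1+u)) ⟩
    foldRange u h ∙ h (suc u) ∎

  foldMap-insertAll : ∀ v l → All (λ ρ → ∀ f → foldMap ρ f ≈ f v ∙ foldMap l f) (insertAll v l)
  foldMap-insertAll v []       = (λ f → refl) ∷ []
  foldMap-insertAll v (u ∷ us) = (λ f → refl) ∷ All.map⁺ (All.map (λ {ρ} ρ≈ f → begin
    f u ∙ foldMap ρ f           ≈⟨ ∙-congˡ (ρ≈ f) ⟩
    f u ∙ (f v ∙ foldMap us f)  ≈⟨ solve 3 (λ a b c → a ⊕ (b ⊕ c) ⊜ b ⊕ (a ⊕ c)) refl _ _ _ ⟩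
    f v ∙ (f u ∙ foldMap us f)  ∎) (foldMap-insertAll v us))

  foldMap-S : ∀ n → All (λ σ → ∀ f → foldMap σ f ≈ foldRange n f) (S n)
  foldMap-S zero    = (λ f → refl) ∷ []
  foldMap-S (suc n) = All.concat⁺ (All.map⁺ (All.map (λ {σ} σ≈ → All.map (λ {ρ} ρ≈ f →
    trans (ρ≈ f) (trans (∙-congˡ (σ≈ f)) (comm _ _))) (foldMap-insertAll (suc n) σ)) (foldMap-S n)))

  foldMap-S-suc : ∀ n f → foldMap (S (suc n)) f ≈
    foldRange (suc n) (λ i → foldMap (S n) (λ σ → f (i ∷ map (punchIn i) σ)))
  foldMap-S-suc zero    f = sym (identityˡ _)
  foldMap-S-suc (suc n) f = begin
    foldMap (S (suc (suc n))) f
      ≈⟨ foldMap-concatMap (insertAll (suc (suc n))) (S (suc n)) f ⟩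
    foldMap (S (suc n)) inserted
      ≈⟨ foldMap-S-suc n inserted ⟩
    foldRange (suc n) (λ i → foldMap (S n) (λ σ → inserted (i ∷ map (punchIn i) σ)))
      ≈⟨ foldRange-cong (suc n) (λ i (_ , i≤1+n) → foldMap-cong (S n)
           (All.universal (λ σ → ∙-congˡ (reflexive (inserted-behind i≤1+n σ))) _)) ⟩
    foldRange (suc n) (λ i → foldMap (S n) (λ σ → top (i ∷ map (punchIn i) σ) ∙ behind i σ))
      ≈⟨ foldRange-cong (suc n) (λ i _ → foldMap-distrib (S n) _ (behind i)) ⟩
    foldRange (suc n) (λ i → foldMap (S n) (λ σ → top (i ∷ map (punchIn i) σ)) ∙ foldMap (S n) (behind i))
      ≈⟨ foldRange-distrib (suc n) _ _ ⟩
    foldRange (suc n) (λ i → foldMap (S n) (λ σ → top (i ∷ map (punchIn i) σ))) ∙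
      foldRange (suc n) (λ i → foldMap (S n) (behind i))
      ≈⟨ ∙-cong (sym (foldMap-S-suc n top)) (foldRange-cong (suc n) (λ i _ →
           sym (foldMap-concatMap (insertAll (suc n)) (S n) (λ ρ → f (i ∷ map (punchIn i) ρ))))) ⟩
    foldMap (S (suc n)) top ∙ foldRange (suc n) (λ i → foldMap (S (suc n)) (λ ρ → f (i ∷ map (punchIn i) ρ)))
      ≈⟨ comm _ _ ⟩
    foldRange (suc n) (λ i → foldMap (S (suc n)) (λ ρ → f (i ∷ map (punchIn i) ρ))) ∙ foldMap (S (suc n)) top
      ≈⟨ ∙-congˡ (foldMap-cong (S (suc n)) (All.map (λ {ρ} ρ⊆[1,1+n] →
           reflexive (cong top (≡.sym (map-punchIn-beyond ρ ρ⊆[1,1+n])))) (S-bounded (suc n)))) ⟩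
    foldRange (suc (suc n)) (λ i → foldMap (S (suc n)) (λ ρ → f (i ∷ map (punchIn i) ρ))) ∎
    where
      inserted : List ℕ → Carrier
      inserted π = foldMap (insertAll (suc (suc n)) π) f
      top : List ℕ → Carrier
      top ρ = f (suc (suc n) ∷ ρ)
      behind : ℕ → List ℕ → Carrier
      behind i σ = foldMap (insertAll (suc n) σ) (λ ρ → f (i ∷ map (punchIn i) ρ))
      inserted-behind : ∀ {i} → i ≤ suc n → ∀ σ →
                        foldMap (map (i ∷_) (insertAll (suc (suc n)) (map (punchIn i) σ))) f ≡ behind i σ
      inserted-behind {i} i≤1+n σ = ≡.trans
        (foldMap-map (i ∷_) (insertAll (suc (suc n)) (map (punchIn i) σ)) f) (≡.trans
        (cong (λ l → foldMap l (λ ρ → f (i ∷ ρ))) (insertAll-punchIn σ i≤1+n))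
        (foldMap-map (map (punchIn i)) (insertAll (suc n) σ) (λ ρ → f (i ∷ ρ))))

module _ {c ℓ : Level} (R : CommutativeRing c ℓ) where
  open CommutativeRing R hiding (zero)
  open WithRing R
  open import Relation.Binary.Reasoning.Setoid setoid
  module Π = BigOperator *-commutativeMonoid
  module Σ = BigOperator +-commutativeMonoid
  open Π using (_^ᵇ_)

  prod≡foldRange : ∀ n f → prod n f ≡ Π.foldRange n f
  prod≡foldRange zero    f = ≡.refl
  prod≡foldRange (suc n) f = cong (_* f (suc n)) (prod≡foldRange n f)

  sum≡foldRange : ∀ n f → sum n f ≡ Σ.foldRange n f
  sum≡foldRange zero    f = ≡.refl
  sum≡foldRange (suc n) f = cong (_+ f (suc n)) (sum≡foldRange n f)

  sumList≡foldMap : ∀ πs f → sumList πs f ≡ Σ.foldMap πs f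
  sumList≡foldMap []       f = ≡.refl
  sumList≡foldMap (π ∷ πs) f = cong (f π +_) (sumList≡foldMap πs f)

  foldMap-*-distribˡ : ∀ {A : Set} (xs : List A) a f → Σ.foldMap xs (λ x → a * f x) ≈ a * Σ.foldMap xs f
  foldMap-*-distribˡ []       a f = sym (zeroʳ a)
  foldMap-*-distribˡ (x ∷ xs) a f = trans (+-congˡ (foldMap-*-distribˡ xs a f)) (sym (distribˡ a _ _))

  ^-length-filter : ∀ {A : Set} {p} {P : A → Set p} (P? : Decidable P) xs x →
                    x ^ length (filter P? xs) ≈ Π.foldMap xs (λ e → x ^ᵇ does (P? e))
  ^-length-filter P? []       x = refl
  ^-length-filter P? (e ∷ xs) x with does (P? e)
  ... | true  = *-congˡ (^-length-filter P? xs x)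
  ... | false = trans (^-length-filter P? xs x) (sym (*-identityˡ _))

  ^≈foldRange : ∀ x k → x ^ k ≈ Π.foldRange k (λ _ → x)
  ^≈foldRange x zero    = refl
  ^≈foldRange x (suc k) = trans (*-comm x (x ^ k)) (*-congʳ (^≈foldRange x k))

  rowTail : Mat → ℕ → ℕ → Carrier
  rowTail M a b = Π.foldRange a (λ j → M a j ^ᵇ does (b <? j))

  pairFactor : Mat → ℕ × ℕ → Carrier
  pairFactor X (a , b) = rowTail X a b

  tripleFactor : Mat → ℕ × ℕ × ℕ → Carrier
  tripleFactor Y (a , b , c) = rowTail Y a c ^ᵇ does (a <? b)

  quadFactor : Carrier → ℕ × ℕ × ℕ × ℕ → Carrier
  quadFactor t (a , b , c , d) = t ^ᵇ (does (d <? a) ∧ (does (a <? b) ∧ does (b <? c)))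

  localWeight : Carrier → Mat → Mat → List ℕ → Carrier
  localWeight t X Y π = Π.foldMap (quads π) (quadFactor t) *
                        (Π.foldMap (pairs π) (pairFactor X) * Π.foldMap (triples π) (tripleFactor Y))

  prod-triangle : ∀ m (f : ℕ → ℕ → Carrier) →
                  prod m (λ i → prod i (f i)) ≈ Π.foldRange m (λ i → Π.foldRange i (f i))
  prod-triangle m f = trans (reflexive (prod≡foldRange m _))
                            (Π.foldRange-cong m (λ i _ → reflexive (prod≡foldRange i (f i))))

  triangle-foldMap : ∀ m {A : Set} (xs : List A) (row : A → ℕ) (F : ℕ → ℕ → A → Carrier) (G : A → ℕ → Carrier) →
    All (λ p → row p ∈[1, m ]) xs →
    (∀ p i j → i ≢ row p → F i j p ≈ 1#) → (∀ p j → j ≤ row p → F (row p) j p ≈ G p j) →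
    Π.foldRange m (λ i → Π.foldRange i (λ j → Π.foldMap xs (F i j))) ≈
    Π.foldMap xs (λ p → Π.foldRange (row p) (G p))
  triangle-foldMap m xs row F G rows off on = begin
    Π.foldRange m (λ i → Π.foldRange i (λ j → Π.foldMap xs (F i j)))
      ≈⟨ Π.foldRange-cong m (λ i _ → Π.foldRange-foldMap i xs (λ j → F i j)) ⟩
    Π.foldRange m (λ i → Π.foldMap xs (λ p → Π.foldRange i (λ j → F i j p)))
      ≈⟨ Π.foldRange-foldMap m xs _ ⟩
    Π.foldMap xs (λ p → Π.foldRange m (λ i → Π.foldRange i (λ j → F i j p)))
      ≈⟨ Π.foldMap-cong xs (All.map (λ {p} row∈ → trans
           (Π.foldRange-single m row∈ (λ i i≢row → Π.foldRange-ε i (λ j _ → off p i j i≢row)))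
           (Π.foldRange-cong (row p) (λ j (_ , j≤row) → on p j j≤row))) rows) ⟩
    Π.foldMap xs (λ p → Π.foldRange (row p) (G p)) ∎

  xWeight≈pairFactors : ∀ m X π → All (_∈[1, m ]) π →
           Π.foldRange m (λ i → Π.foldRange i (λ j → X i j ^ xExp π i j)) ≈ Π.foldMap (pairs π) (pairFactor X)
  xWeight≈pairFactors m X π π⊆ = begin
    Π.foldRange m (λ i → Π.foldRange i (λ j → X i j ^ xExp π i j))
      ≈⟨ Π.foldRange-cong m (λ i _ → Π.foldRange-cong i (λ j _ → ^-length-filter _ (pairs π) (X i j))) ⟩
    Π.foldRange m (λ i → Π.foldRange i (λ j → Π.foldMap (pairs π) (λ p → X i j ^ᵇ counted i j p)))
      ≈⟨ triangle-foldMap m (pairs π) proj₁ _ (λ (a , b) j → X a j ^ᵇ does (b <? j)) (pairs-All π⊆) off on ⟩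
    Π.foldMap (pairs π) (pairFactor X) ∎
    where
      counted : ℕ → ℕ → ℕ × ℕ → Bool
      counted i j (a , b) = does (b <? a) ∧ (does (a ≟ i) ∧ does (b <? j))
      off : ∀ p i j → i ≢ proj₁ p → X i j ^ᵇ counted i j p ≈ 1#
      off (a , b) i j i≢a = reflexive (cong (X i j ^ᵇ_) (≡.trans
        (cong (λ q → does (b <? a) ∧ (q ∧ does (b <? j))) (dec-false (a ≟ i) (i≢a ∘ ≡.sym)))
        (∧-zeroʳ (does (b <? a)))))
      on : ∀ p j → j ≤ proj₁ p → X (proj₁ p) j ^ᵇ counted (proj₁ p) j p ≈ X (proj₁ p) j ^ᵇ does (proj₂ p <? j)
      on (a , b) j j≤a = reflexive (cong (X a j ^ᵇ_) (≡.trans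
        (cong (λ q → does (b <? a) ∧ (q ∧ does (b <? j))) (dec-true (a ≟ a) ≡.refl))
        (∧-does-absorb (b <? a) (b <? j) (λ b<j → <-≤-trans b<j j≤a))))

  yWeight≈tripleFactors : ∀ m Y π → All (_∈[1, m ]) π →
           Π.foldRange m (λ i → Π.foldRange i (λ j → Y i j ^ yExp π i j)) ≈ Π.foldMap (triples π) (tripleFactor Y)
  yWeight≈tripleFactors m Y π π⊆ = begin
    Π.foldRange m (λ i → Π.foldRange i (λ j → Y i j ^ yExp π i j))
      ≈⟨ Π.foldRange-cong m (λ i _ → Π.foldRange-cong i (λ j _ → ^-length-filter _ (triples π) (Y i j))) ⟩
    Π.foldRange m (λ i → Π.foldRange i (λ j → Π.foldMap (triples π) (λ p → Y i j ^ᵇ counted i j p)))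
      ≈⟨ triangle-foldMap m (triples π) proj₁ _ G (triples-All π⊆) off on ⟩
    Π.foldMap (triples π) (λ p → Π.foldRange (proj₁ p) (G p))
      ≈⟨ Π.foldMap-cong (triples π) (All.universal (λ (a , b , c) → trans
           (Π.foldRange-cong a (λ j _ → reflexive (Π.^ᵇ-∧ (Y a j) (does (a <? b)) _)))
           (Π.foldRange-^ᵇ a (does (a <? b)) _)) _) ⟩
    Π.foldMap (triples π) (tripleFactor Y) ∎
    where
      counted : ℕ → ℕ → ℕ × ℕ × ℕ → Bool
      counted i j (a , b , c) = does (c <? a) ∧ (does (a <? b) ∧ (does (a ≟ i) ∧ does (c <? j)))
      G : ℕ × ℕ × ℕ → ℕ → Carrier
      G (a , b , c) j = Y a j ^ᵇ (does (a <? b) ∧ does (c <? j))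
      off : ∀ p i j → i ≢ proj₁ p → Y i j ^ᵇ counted i j p ≈ 1#
      off (a , b , c) i j i≢a = reflexive (cong (Y i j ^ᵇ_) (≡.trans
        (cong (λ q → does (c <? a) ∧ (does (a <? b) ∧ (q ∧ does (c <? j)))) (dec-false (a ≟ i) (i≢a ∘ ≡.sym)))
        (≡.trans (cong (does (c <? a) ∧_) (∧-zeroʳ (does (a <? b)))) (∧-zeroʳ (does (c <? a))))))
      on : ∀ p j → j ≤ proj₁ p → Y (proj₁ p) j ^ᵇ counted (proj₁ p) j p ≈ G p j
      on (a , b , c) j j≤a = reflexive (cong (Y a j ^ᵇ_) (≡.trans
        (cong (λ q → does (c <? a) ∧ (does (a <? b) ∧ (q ∧ does (c <? j)))) (dec-true (a ≟ a) ≡.refl))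
        (∧-does-absorb (c <? a) ((a <? b) ×-dec (c <? j)) (λ (_ , c<j) → <-≤-trans c<j j≤a))))

  weight≈localWeight : ∀ m t X Y π → All (_∈[1, m ]) π → weight m t X Y π ≈ localWeight t X Y π
  weight≈localWeight m t X Y π π⊆ = *-cong (^-length-filter _ (quads π) t) (begin
    prod m (λ i → prod i (λ j → X i j ^ xExp π i j * Y i j ^ yExp π i j))
      ≈⟨ prod-triangle m _ ⟩
    Π.foldRange m (λ i → Π.foldRange i (λ j → X i j ^ xExp π i j * Y i j ^ yExp π i j))
      ≈⟨ Π.foldRange-cong m (λ i _ → Π.foldRange-distrib i _ _) ⟩
    Π.foldRange m (λ i → Π.foldRange i (λ j → X i j ^ xExp π i j) * Π.foldRange i (λ j → Y i j ^ yExp π i j))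
      ≈⟨ Π.foldRange-distrib m _ _ ⟩
    Π.foldRange m (λ i → Π.foldRange i (λ j → X i j ^ xExp π i j)) *
      Π.foldRange m (λ i → Π.foldRange i (λ j → Y i j ^ yExp π i j))
      ≈⟨ *-cong (xWeight≈pairFactors m X π π⊆) (yWeight≈tripleFactors m Y π π⊆) ⟩
    Π.foldMap (pairs π) (pairFactor X) * Π.foldMap (triples π) (tripleFactor Y) ∎)

  R2-upperLeft : ∀ {N X Y i b c} → b < i → c < i → R2 N X Y i b c ≡ X b c
  R2-upperLeft {N} {i = i} {b} {c} b<i c<i with i ≟ N
  ... | yes _ = ≡.refl
  ... | no  _ with b <? i | c <? i
  ... | yes _   | yes _   = ≡.refl
  ... | no  b≮i | _       = contradiction b<i b≮i
  ... | yes _   | no  c≮i = contradiction c<i c≮i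

  R2-lowerLeft : ∀ {N X Y i b c} → i ≢ N → ¬ b < i → c < i → R2 N X Y i b c ≡ Y i c * X (suc b) c
  R2-lowerLeft {N} {i = i} {b} {c} i≢N b≮i c<i with i ≟ N
  ... | yes i≡N = contradiction i≡N i≢N
  ... | no  _ with b <? i | c <? i
  ... | yes b<i | _       = contradiction b<i b≮i
  ... | no  _   | yes _   = ≡.refl
  ... | no  _   | no  c≮i = contradiction c<i c≮i

  R2-lowerDiagonal : ∀ {N X Y i b} → i ≢ N → ¬ b < i →
                     R2 N X Y i b i ≡ Y i i * X (suc b) i * X (suc b) (suc i)
  R2-lowerDiagonal {N} {i = i} {b} i≢N b≮i with i ≟ N
  ... | yes i≡N = contradiction i≡N i≢N
  ... | no  _ with b <? i | i <? i | i ≟ i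
  ... | yes b<i | _       | _       = contradiction b<i b≮i
  ... | no  _   | yes i<i | _       = contradiction i<i (<-irrefl ≡.refl)
  ... | no  _   | no  _   | yes _   = ≡.refl
  ... | no  _   | no  _   | no  i≢i = contradiction ≡.refl i≢i

  R2-lowerRight : ∀ {N X Y i b c} → i ≢ N → ¬ b < i → i < c → R2 N X Y i b c ≡ X (suc b) (suc c)
  R2-lowerRight {N} {i = i} {b} {c} i≢N b≮i i<c with i ≟ N
  ... | yes i≡N = contradiction i≡N i≢N
  ... | no  _ with b <? i | c <? i | c ≟ i
  ... | yes b<i | _       | _       = contradiction b<i b≮i
  ... | no  _   | yes c<i | _       = contradiction c<i (<-asym i<c)
  ... | no  _   | no  _   | yes c≡i = contradiction (≡.sym c≡i) (<⇒≢ i<c)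
  ... | no  _   | no  _   | no  _   = ≡.refl

  R1-upperLeft : ∀ {t N M i b c} → b < i → c < i → R1 t N M i b c ≡ M b c
  R1-upperLeft {N = N} {i = i} {b} {c} b<i c<i with i ≟ N
  ... | yes _ = ≡.refl
  ... | no  _ with b <? i
  ... | no  b≮i = contradiction b<i b≮i
  ... | yes _ with c <? i
  ... | yes _   = ≡.refl
  ... | no  c≮i = contradiction c<i c≮i

  R1-lowerLeft : ∀ {t N M i b c} → i ≢ N → ¬ b < i → c < i → R1 t N M i b c ≡ M (suc b) c
  R1-lowerLeft {N = N} {i = i} {b} {c} i≢N b≮i c<i with i ≟ N
  ... | yes i≡N = contradiction i≡N i≢N
  ... | no  _ with b <? i
  ... | yes b<i = contradiction b<i b≮i
  ... | no  _ with c <? i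
  ... | yes _   = ≡.refl
  ... | no  c≮i = contradiction c<i c≮i

  R1-lowerDiagonal : ∀ {t N M i b} → i ≢ N → ¬ b < i → R1 t N M i b i ≡ t * M (suc b) i * M (suc b) (suc i)
  R1-lowerDiagonal {N = N} {i = i} {b} i≢N b≮i with i ≟ N
  ... | yes i≡N = contradiction i≡N i≢N
  ... | no  _ with b <? i
  ... | yes b<i = contradiction b<i b≮i
  ... | no  _ with i <? i | i ≟ i
  ... | yes i<i | _       = contradiction i<i (<-irrefl ≡.refl)
  ... | no  _   | yes _   = ≡.refl
  ... | no  _   | no  i≢i = contradiction ≡.refl i≢i

  R1-lowerRight : ∀ {t N M i b c} → i ≢ N → ¬ b < i → i < c → R1 t N M i b c ≡ M (suc b) (suc c)
  R1-lowerRight {N = N} {i = i} {b} {c} i≢N b≮i i<c with i ≟ N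
  ... | yes i≡N = contradiction i≡N i≢N
  ... | no  _ with b <? i
  ... | yes b<i = contradiction b<i b≮i
  ... | no  _ with c <? i | c ≟ i
  ... | yes c<i | _       = contradiction c<i (<-asym i<c)
  ... | no  _   | yes c≡i = contradiction (≡.sym c≡i) (<⇒≢ i<c)
  ... | no  _   | no  _   = ≡.refl

  rowTail-R2-upper : ∀ {N X Y i u} v → u < i → rowTail (R2 N X Y i) u v ≈ rowTail X u (punchIn i v)
  rowTail-R2-upper {i = i} {u} v u<i = Π.foldRange-cong u (λ j (_ , j≤u) →
    reflexive (cong₂ _^ᵇ_ (R2-upperLeft u<i (≤-<-trans j≤u u<i))
                          (≡.sym (<?-punchIn-below i v (<⇒≤ (≤-<-trans j≤u u<i))))))

  rowTail-R1-upper : ∀ {t N M i u} w → u < i → rowTail (R1 t N M i) u w ≈ rowTail M u (punchIn i w)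
  rowTail-R1-upper {i = i} {u} w u<i = Π.foldRange-cong u (λ j (_ , j≤u) →
    reflexive (cong₂ _^ᵇ_ (R1-upperLeft u<i (≤-<-trans j≤u u<i))
                          (≡.sym (<?-punchIn-below i w (<⇒≤ (≤-<-trans j≤u u<i))))))

  rowTail-R1-lower : ∀ {t N M i u} w → 1 ≤ i → i ≤ u → i ≢ N →
    rowTail (R1 t N M i) u w ≈ t ^ᵇ does (w <? i) * rowTail M (suc u) (punchIn i w)
  rowTail-R1-lower {t} {N} {M} {i} {u} w 1≤i i≤u i≢N = sym (Π.foldRange-merge u 1≤i i≤u below at above)
    where
      u≮i = ≤⇒≯ i≤u
      g : ℕ → Carrier
      g j = M (suc u) j ^ᵇ does (punchIn i w <? j)
      below : ∀ j → j < i → R1 t N M i u j ^ᵇ does (w <? j) ≈ g j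
      below j j<i = reflexive (cong₂ _^ᵇ_ (R1-lowerLeft i≢N u≮i j<i) (≡.sym (<?-punchIn-below i w (<⇒≤ j<i))))
      at : R1 t N M i u i ^ᵇ does (w <? i) ≈ t ^ᵇ does (w <? i) * (g i * g (suc i))
      at = begin
        R1 t N M i u i ^ᵇ does (w <? i)
          ≡⟨ cong (_^ᵇ does (w <? i)) (R1-lowerDiagonal i≢N u≮i) ⟩
        (t * M (suc u) i * M (suc u) (suc i)) ^ᵇ does (w <? i)
          ≈⟨ trans (Π.^ᵇ-distrib (t * M (suc u) i) (M (suc u) (suc i)) (does (w <? i)))
                   (*-congʳ (Π.^ᵇ-distrib t (M (suc u) i) (does (w <? i)))) ⟩
        t ^ᵇ does (w <? i) * M (suc u) i ^ᵇ does (w <? i) * M (suc u) (suc i) ^ᵇ does (w <? i)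
          ≈⟨ *-assoc _ _ _ ⟩
        t ^ᵇ does (w <? i) * (M (suc u) i ^ᵇ does (w <? i) * M (suc u) (suc i) ^ᵇ does (w <? i))
          ≡⟨ cong₂ (λ p q → t ^ᵇ does (w <? i) * (M (suc u) i ^ᵇ p * M (suc u) (suc i) ^ᵇ q))
                   (<?-punchIn-below i w ≤-refl) (<?-punchIn-above i w ≤-refl) ⟨
        t ^ᵇ does (w <? i) * (g i * g (suc i)) ∎
      above : ∀ j → i < j → R1 t N M i u j ^ᵇ does (w <? j) ≈ g (suc j)
      above j i<j = reflexive (cong₂ _^ᵇ_ (R1-lowerRight i≢N u≮i i<j) (≡.sym (<?-punchIn-above i w (<⇒≤ i<j))))

  R2-lower≈R1 : ∀ {N X Y i u} j → i ≢ N → ¬ u < i → R2 N X Y i u j ≈ Y i j ^ᵇ does (j ≤? i) * R1 1# N X i u j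
  R2-lower≈R1 {N} {X} {Y} {i} {u} j i≢N u≮i with <-cmp j i
  ... | tri< j<i _ _ = reflexive (≡.trans (R2-lowerLeft i≢N u≮i j<i) (cong₂ _*_
        (cong (Y i j ^ᵇ_) (≡.sym (dec-true (j ≤? i) (<⇒≤ j<i)))) (≡.sym (R1-lowerLeft i≢N u≮i j<i))))
  ... | tri≈ _ ≡.refl _ = begin
    R2 N X Y i u i                              ≡⟨ R2-lowerDiagonal i≢N u≮i ⟩
    Y i i * X (suc u) i * X (suc u) (suc i)     ≈⟨ *-assoc _ _ _ ⟩
    Y i i * (X (suc u) i * X (suc u) (suc i))   ≈⟨ *-congˡ (*-congʳ (*-identityˡ _)) ⟨
    Y i i * (1# * X (suc u) i * X (suc u) (suc i))
      ≡⟨ cong₂ _*_ (cong (Y i i ^ᵇ_) (dec-true (i ≤? i) ≤-refl)) (R1-lowerDiagonal i≢N u≮i) ⟨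
    Y i i ^ᵇ does (i ≤? i) * R1 1# N X i u i    ∎
  ... | tri> _ _ i<j = begin
    R2 N X Y i u j                              ≡⟨ R2-lowerRight i≢N u≮i i<j ⟩
    X (suc u) (suc j)                           ≈⟨ *-identityˡ _ ⟨
    1# * X (suc u) (suc j)
      ≡⟨ cong₂ _*_ (cong (Y i j ^ᵇ_) (dec-false (j ≤? i) (<⇒≱ i<j))) (R1-lowerRight i≢N u≮i i<j) ⟨
    Y i j ^ᵇ does (j ≤? i) * R1 1# N X i u j    ∎

  rowTail-R2-lower : ∀ {N X Y i u} v → 1 ≤ i → i ≤ u → i ≢ N →
    rowTail (R2 N X Y i) u v ≈ rowTail X (suc u) (punchIn i v) * rowTail Y i (punchIn i v)
  rowTail-R2-lower {N} {X} {Y} {i} {u} v 1≤i i≤u i≢N = begin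
    rowTail (R2 N X Y i) u v
      ≈⟨ Π.foldRange-cong u (λ j _ → Π.^ᵇ-congˡ (does (v <? j)) (R2-lower≈R1 j i≢N (≤⇒≯ i≤u))) ⟩
    Π.foldRange u (λ j → (Y i j ^ᵇ does (j ≤? i) * R1 1# N X i u j) ^ᵇ does (v <? j))
      ≈⟨ Π.foldRange-cong u (λ j _ → Π.^ᵇ-distrib (Y i j ^ᵇ does (j ≤? i)) (R1 1# N X i u j) (does (v <? j))) ⟩
    Π.foldRange u (λ j → (Y i j ^ᵇ does (j ≤? i)) ^ᵇ does (v <? j) * R1 1# N X i u j ^ᵇ does (v <? j))
      ≈⟨ Π.foldRange-distrib u _ _ ⟩
    Π.foldRange u (λ j → (Y i j ^ᵇ does (j ≤? i)) ^ᵇ does (v <? j)) * rowTail (R1 1# N X i) u v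
      ≈⟨ *-cong (Π.foldRange-cong u (λ j _ → reflexive (rowY j))) (rowTail-R1-lower v 1≤i i≤u i≢N) ⟩
    Π.foldRange u (λ j → (Y i j ^ᵇ does (v′ <? j)) ^ᵇ does (j ≤? i)) * (1# ^ᵇ does (v <? i) * rowTail X (suc u) v′)
      ≈⟨ *-cong (Π.foldRange-truncate u _ i≤u) (trans (*-congʳ (reflexive (Π.ε-^ᵇ (does (v <? i))))) (*-identityˡ _)) ⟩
    rowTail Y i v′ * rowTail X (suc u) v′
      ≈⟨ *-comm _ _ ⟩
    rowTail X (suc u) v′ * rowTail Y i v′ ∎
    where
      v′ = punchIn i v
      rowY : ∀ j → (Y i j ^ᵇ does (j ≤? i)) ^ᵇ does (v <? j) ≡ (Y i j ^ᵇ does (v′ <? j)) ^ᵇ does (j ≤? i)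
      rowY j = Π.^ᵇ-guarded-comm (Y i j) (j ≤? i) (λ j≤i → ≡.sym (<?-punchIn-below i v j≤i))

  pairFactor-punchIn : ∀ n X Y {i} (p : ℕ × ℕ) → 1 ≤ i → proj₁ p ≤ n →
    pairFactor X (map² (punchIn i) p) * tripleFactor Y (i , map² (punchIn i) p) ≈ pairFactor (R2 (suc n) X Y i) p
  pairFactor-punchIn n X Y {i} (u , v) 1≤i u≤n with u <? i
  ... | yes u<i = begin
    rowTail X u (punchIn i v) * rowTail Y i (punchIn i v) ^ᵇ does (i <? u)
      ≡⟨ cong (λ b → rowTail X u (punchIn i v) * rowTail Y i (punchIn i v) ^ᵇ b) (dec-false (i <? u) (<-asym u<i)) ⟩
    rowTail X u (punchIn i v) * 1#
      ≈⟨ *-identityʳ _ ⟩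
    rowTail X u (punchIn i v)
      ≈⟨ rowTail-R2-upper v u<i ⟨
    rowTail (R2 (suc n) X Y i) u v ∎
  ... | no  u≮i = begin
    rowTail X (suc u) (punchIn i v) * rowTail Y i (punchIn i v) ^ᵇ does (i <? suc u)
      ≡⟨ cong (λ b → rowTail X (suc u) (punchIn i v) * rowTail Y i (punchIn i v) ^ᵇ b)
              (dec-true (i <? suc u) (s≤s i≤u)) ⟩
    rowTail X (suc u) (punchIn i v) * rowTail Y i (punchIn i v)
      ≈⟨ rowTail-R2-lower v 1≤i i≤u (<⇒≢ (s≤s (≤-trans i≤u u≤n))) ⟨
    rowTail (R2 (suc n) X Y i) u v ∎
    where i≤u = ≮⇒≥ u≮i

  tripleFactor-punchIn : ∀ n t Y {i} (p : ℕ × ℕ × ℕ) → 1 ≤ i → proj₁ p ≤ n →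
    quadFactor t (i , map³ (punchIn i) p) * tripleFactor Y (map³ (punchIn i) p) ≈ tripleFactor (R1 t (suc n) Y i) p
  tripleFactor-punchIn n t Y {i} (u , v , w) 1≤i u≤n with u <? i
  ... | yes u<i = begin
    t ^ᵇ (does (w′ <? i) ∧ (does (i <? u) ∧ does (u <? v′))) * rowTail Y u w′ ^ᵇ does (u <? v′)
      ≡⟨ cong₂ (λ p q → t ^ᵇ (does (w′ <? i) ∧ (p ∧ q)) * rowTail Y u w′ ^ᵇ q)
               (dec-false (i <? u) (<-asym u<i)) ordered ⟩
    t ^ᵇ (does (w′ <? i) ∧ false) * rowTail Y u w′ ^ᵇ does (u <? v)
      ≡⟨ cong (λ b → t ^ᵇ b * rowTail Y u w′ ^ᵇ does (u <? v)) (∧-zeroʳ (does (w′ <? i))) ⟩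
    1# * rowTail Y u w′ ^ᵇ does (u <? v)
      ≈⟨ *-identityˡ _ ⟩
    rowTail Y u w′ ^ᵇ does (u <? v)
      ≈⟨ Π.^ᵇ-congˡ (does (u <? v)) (rowTail-R1-upper w u<i) ⟨
    rowTail (R1 t (suc n) Y i) u w ^ᵇ does (u <? v) ∎
    where
      v′ = punchIn i v
      w′ = punchIn i w
      ordered : does (u <? v′) ≡ does (u <? v)
      ordered = ≡.trans (cong (λ x → does (x <? v′)) (≡.sym (punchIn-< u<i))) (<?-punchIn i u v)
  ... | no u≮i = begin
    t ^ᵇ (does (w′ <? i) ∧ (does (i <? suc u) ∧ does (suc u <? v′))) * rowTail Y (suc u) w′ ^ᵇ does (suc u <? v′)
      ≡⟨ cong₂ (λ c q → t ^ᵇ (c ∧ (does (i <? suc u) ∧ q)) * rowTail Y (suc u) w′ ^ᵇ q)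
               (<?-punchIn-below i w ≤-refl) ordered ⟩
    t ^ᵇ (does (w <? i) ∧ (does (i <? suc u) ∧ does (u <? v))) * rowTail Y (suc u) w′ ^ᵇ does (u <? v)
      ≡⟨ cong (λ p → t ^ᵇ (does (w <? i) ∧ (p ∧ does (u <? v))) * rowTail Y (suc u) w′ ^ᵇ does (u <? v))
              (dec-true (i <? suc u) (s≤s i≤u)) ⟩
    t ^ᵇ (does (w <? i) ∧ does (u <? v)) * rowTail Y (suc u) w′ ^ᵇ does (u <? v)
      ≡⟨ cong (_* rowTail Y (suc u) w′ ^ᵇ does (u <? v))
              (≡.trans (Π.^ᵇ-∧ t (does (w <? i)) (does (u <? v))) (Π.^ᵇ-comm t (does (u <? v)) (does (w <? i)))) ⟩
    (t ^ᵇ does (w <? i)) ^ᵇ does (u <? v) * rowTail Y (suc u) w′ ^ᵇ does (u <? v)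
      ≈⟨ Π.^ᵇ-distrib (t ^ᵇ does (w <? i)) (rowTail Y (suc u) w′) (does (u <? v)) ⟨
    (t ^ᵇ does (w <? i) * rowTail Y (suc u) w′) ^ᵇ does (u <? v)
      ≈⟨ Π.^ᵇ-congˡ (does (u <? v)) (rowTail-R1-lower w 1≤i i≤u (<⇒≢ (s≤s (≤-trans i≤u u≤n)))) ⟨
    rowTail (R1 t (suc n) Y i) u w ^ᵇ does (u <? v) ∎
    where
      i≤u = ≮⇒≥ u≮i
      v′ = punchIn i v
      w′ = punchIn i w
      ordered : does (suc u <? v′) ≡ does (u <? v)
      ordered = ≡.trans (cong (λ x → does (x <? v′)) (≡.sym (punchIn-≮ u≮i))) (<?-punchIn i u v)

  quadFactor-punchIn : ∀ t i q → quadFactor t (map⁴ (punchIn i) q) ≡ quadFactor t q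
  quadFactor-punchIn t i (a , b , c , d) = cong (t ^ᵇ_)
    (cong₂ _∧_ (<?-punchIn i d a) (cong₂ _∧_ (<?-punchIn i a b) (<?-punchIn i b c)))

  rowTail-monomial : ∀ n X {i σ} → i ≤ suc n → σ ∈ S n →
                     Π.foldMap σ (λ v → rowTail X i (punchIn i v)) ≈ monomial X i
  rowTail-monomial n X {i} {σ} i≤1+n σ∈S = begin
    Π.foldMap σ (λ v → Π.foldRange i (λ j → X i j ^ᵇ does (punchIn i v <? j)))
      ≈⟨ Π.foldRange-foldMap i σ _ ⟨
    Π.foldRange i (λ j → Π.foldMap σ (λ v → X i j ^ᵇ does (punchIn i v <? j)))
      ≈⟨ Π.foldRange-cong i column ⟩
    Π.foldRange i (λ j → X i j ^ (j ∸ 1))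
      ≡⟨ prod≡foldRange i _ ⟨
    monomial X i ∎
    where
      column : ∀ j → j ∈[1, i ] → Π.foldMap σ (λ v → X i j ^ᵇ does (punchIn i v <? j)) ≈ X i j ^ (j ∸ 1)
      column (suc k) (_ , 1+k≤i) = begin
        Π.foldMap σ (λ v → X i (suc k) ^ᵇ does (punchIn i v <? suc k))
          ≈⟨ Π.foldMap-cong σ (All.universal (λ v → reflexive (cong (X i (suc k) ^ᵇ_)
               (≡.trans (<?-punchIn-below i v 1+k≤i) (does-≡ (v <? suc k) (v ≤? k) ≤-pred s≤s)))) _) ⟩
        Π.foldMap σ (λ v → X i (suc k) ^ᵇ does (v ≤? k))
          ≈⟨ All.lookup (Π.foldMap-S n) σ∈S _ ⟩
        Π.foldRange n (λ v → X i (suc k) ^ᵇ does (v ≤? k))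
          ≈⟨ Π.foldRange-truncate n (λ _ → X i (suc k)) (≤-pred (≤-trans 1+k≤i i≤1+n)) ⟩
        Π.foldRange k (λ _ → X i (suc k))
          ≈⟨ ^≈foldRange (X i (suc k)) k ⟨
        X i (suc k) ^ k ∎

  localWeight-∷ : ∀ t X Y i τ → localWeight t X Y (i ∷ τ) ≈
    Π.foldMap τ (rowTail X i) *
    (Π.foldMap (quads τ) (quadFactor t) *
     (Π.foldMap (pairs τ) (λ p → pairFactor X p * tripleFactor Y (i , p)) *
      Π.foldMap (triples τ) (λ p → quadFactor t (i , p) * tripleFactor Y p)))
  localWeight-∷ t X Y i τ = begin
    localWeight t X Y (i ∷ τ)
      ≈⟨ *-cong (Π.foldMap-map-++ (i ,_) (triples τ) (quads τ) (quadFactor t))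
                (*-cong (Π.foldMap-map-++ (i ,_) τ (pairs τ) (pairFactor X))
                        (Π.foldMap-map-++ (i ,_) (pairs τ) (triples τ) (tripleFactor Y))) ⟩
    (Qᵢ * Q) * ((Xᵢ * X′) * (Yᵢ * Y′))
      ≈⟨ solve 6 (λ Qᵢ Q Xᵢ X′ Yᵢ Y′ → (Qᵢ ⊕ Q) ⊕ ((Xᵢ ⊕ X′) ⊕ (Yᵢ ⊕ Y′)) ⊜ Xᵢ ⊕ (Q ⊕ ((X′ ⊕ Yᵢ) ⊕ (Qᵢ ⊕ Y′))))
               refl Qᵢ Q Xᵢ X′ Yᵢ Y′ ⟩
    Xᵢ * (Q * ((X′ * Yᵢ) * (Qᵢ * Y′)))
      ≈⟨ *-congˡ (*-congˡ (*-cong (Π.foldMap-distrib (pairs τ) _ _) (Π.foldMap-distrib (triples τ) _ _))) ⟨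
    Π.foldMap τ (rowTail X i) *
    (Π.foldMap (quads τ) (quadFactor t) *
     (Π.foldMap (pairs τ) (λ p → pairFactor X p * tripleFactor Y (i , p)) *
      Π.foldMap (triples τ) (λ p → quadFactor t (i , p) * tripleFactor Y p))) ∎
    where
      open import Algebra.Solver.CommutativeMonoid *-commutativeMonoid using (solve; _⊕_; _⊜_)
      Qᵢ = Π.foldMap (triples τ) (λ p → quadFactor t (i , p))
      Q  = Π.foldMap (quads τ) (quadFactor t)
      Xᵢ = Π.foldMap τ (rowTail X i)
      X′ = Π.foldMap (pairs τ) (pairFactor X)
      Yᵢ = Π.foldMap (pairs τ) (λ p → tripleFactor Y (i , p))
      Y′ = Π.foldMap (triples τ) (tripleFactor Y)

  localWeight-∷-map : ∀ t X Y i g σ → localWeight t X Y (i ∷ map g σ) ≈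
    Π.foldMap σ (λ v → rowTail X i (g v)) *
    (Π.foldMap (quads σ) (λ q → quadFactor t (map⁴ g q)) *
     (Π.foldMap (pairs σ) (λ p → pairFactor X (map² g p) * tripleFactor Y (i , map² g p)) *
      Π.foldMap (triples σ) (λ p → quadFactor t (i , map³ g p) * tripleFactor Y (map³ g p))))
  localWeight-∷-map t X Y i g σ = trans (localWeight-∷ t X Y i (map g σ)) (reflexive
    (cong₂ _*_ (Π.foldMap-map g σ _) (cong₂ _*_ (mapped (quads-map g σ))
      (cong₂ _*_ (mapped (pairs-map g σ)) (mapped (triples-map g σ))))))
    where
      mapped : ∀ {A : Set} {xs : List A} {h : A → A} {ys} {f : A → Carrier} →
               xs ≡ map h ys → Π.foldMap xs f ≡ Π.foldMap ys (f ∘ h)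
      mapped {ys = ys} {f} ≡.refl = Π.foldMap-map _ ys f

  weight-∷-punchIn : ∀ n t X Y {i σ} → i ∈[1, suc n ] → σ ∈ S n →
    weight (suc n) t X Y (i ∷ map (punchIn i) σ) ≈
    monomial X i * weight n t (R2 (suc n) X Y i) (R1 t (suc n) Y i) σ
  weight-∷-punchIn n t X Y {i} {σ} i∈[1,1+n] σ∈S = begin
    weight (suc n) t X Y (i ∷ map (punchIn i) σ)
      ≈⟨ weight≈localWeight (suc n) t X Y _ (i∈[1,1+n] ∷ All.map⁺ (All.map (punchIn-∈ i) σ⊆[1,n])) ⟩
    localWeight t X Y (i ∷ map (punchIn i) σ)
      ≈⟨ localWeight-∷-map t X Y i (punchIn i) σ ⟩
    Π.foldMap σ (λ v → rowTail X i (punchIn i v)) *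
      (Π.foldMap (quads σ) (λ q → quadFactor t (map⁴ (punchIn i) q)) *
       (Π.foldMap (pairs σ) (λ p → pairFactor X (map² (punchIn i) p) * tripleFactor Y (i , map² (punchIn i) p)) *
        Π.foldMap (triples σ) (λ p → quadFactor t (i , map³ (punchIn i) p) * tripleFactor Y (map³ (punchIn i) p))))
      ≈⟨ *-cong (rowTail-monomial n X (proj₂ i∈[1,1+n]) σ∈S)
           (*-cong (Π.foldMap-cong (quads σ) (All.universal (reflexive ∘ quadFactor-punchIn t i) _))
           (*-cong (Π.foldMap-cong (pairs σ)
                     (All.map (λ (_ , u≤n) → pairFactor-punchIn n X Y _ 1≤i u≤n) (pairs-All σ⊆[1,n])))
                   (Π.foldMap-cong (triples σ)
                     (All.map (λ (_ , u≤n) → tripleFactor-punchIn n t Y _ 1≤i u≤n) (triples-All σ⊆[1,n]))))) ⟩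
    monomial X i * localWeight t X′ Y′ σ
      ≈⟨ *-congˡ (weight≈localWeight n t X′ Y′ σ σ⊆[1,n]) ⟨
    monomial X i * weight n t X′ Y′ σ ∎
    where
      X′ = R2 (suc n) X Y i
      Y′ = R1 t (suc n) Y i
      1≤i = proj₁ i∈[1,1+n]
      σ⊆[1,n] = All.lookup (S-bounded n) σ∈S

  P-suc : ∀ n t X Y →
    P (suc n) t X Y ≈ sum (suc n) (λ i → monomial X i * P n t (R2 (suc n) X Y i) (R1 t (suc n) Y i))
  P-suc n t X Y = begin
    P (suc n) t X Y
      ≡⟨ sumList≡foldMap (S (suc n)) _ ⟩
    Σ.foldMap (S (suc n)) (weight (suc n) t X Y)
      ≈⟨ Σ.foldMap-S-suc n _ ⟩
    Σ.foldRange (suc n) (λ i → Σ.foldMap (S n) (λ σ → weight (suc n) t X Y (i ∷ map (punchIn i) σ)))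
      ≈⟨ Σ.foldRange-cong (suc n) (λ i i∈ → trans
           (Σ.foldMap-cong (S n) (All.tabulate (weight-∷-punchIn n t X Y i∈)))
           (foldMap-*-distribˡ (S n) (monomial X i) _)) ⟩
    Σ.foldRange (suc n) (λ i → monomial X i * Σ.foldMap (S n) (weight n t (R2 (suc n) X Y i) (R1 t (suc n) Y i)))
      ≈⟨ Σ.foldRange-cong (suc n) (λ i _ → *-congˡ (reflexive (sumList≡foldMap (S n) _))) ⟨
    Σ.foldRange (suc n) (λ i → monomial X i * P n t (R2 (suc n) X Y i) (R1 t (suc n) Y i))
      ≡⟨ sum≡foldRange (suc n) _ ⟨
    sum (suc n) (λ i → monomial X i * P n t (R2 (suc n) X Y i) (R1 t (suc n) Y i)) ∎

mainTheorem9 : ∀ {c ℓ : Level} (R : CommutativeRing c ℓ) (n : ℕ) → 1 ≤ n →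
    (t : CommutativeRing.Carrier R) (X Y : WithRing.Mat R) →
    CommutativeRing._≈_ R (WithRing.P R n t X Y)
      (WithRing.sum R n (λ i → CommutativeRing._*_ R (WithRing.monomial R X i)
        (WithRing.P R (n ∸ 1) t (WithRing.R2 R n X Y i) (WithRing.R1 R t n Y i))))
mainTheorem9 R (suc n) _ = P-suc R n
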